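{- Let $m>1$ be an integer and let $A$ be an $m$-extension with ${\rm Kunz}^p(A)=(k_1,\dots,k_{m-1})$, genus $g$ and depth $q$. Then $g=\sum_{i=1}^{m-1}k_i$ and $q=\max\{k_i: 1\le i\le m-1\}$.
   Context: For integers $a,b$, $[a,b]=\{x\in\mathbb Z: a\le x\le b\}$; $\mathbb N$ is the set of positive integers, $\mathbb N_0=\mathbb N\cup\{0\}$. For an integer $m>1$, an $m$-extension is a finite set $A\subset\mathbb N$ containing $[1,m-1]$ that admits a partition $A=A_0\cup A_1\cup\dots\cup A_t$ for some $t\in\mathbb N_0$, where $A_0=[1,m-1]$ and $A_{i+1}\subseteq m+A_i$ for all $i$. Its genus is $g(A)=\#A$, its conductor is $c(A)=\min\{s\in\mathbb N_0: s+n\notin A \text{ for all } n\in\mathbb N_0\}$ and its depth is $q(A)=\lceil c(A)/m\rceil$. The pseudo Kunz coordinates: for $i\in[1,m-1]$ let $w_i=m+\max\{a\in A: a\equiv i\pmod m\}$ and write $w_i=mk_i+i$; then ${\rm Kunz}^p(A)=(k_1,\dots,k_{m-1})$. -}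

module Defs where

open import Data.Nat using (ℕ; zero; suc; _+_; _*_; _∸_; _≤_; _<_; _⊔_)
open import Data.Nat.DivMod using (_/_; _%_)
open import Data.List using (List; length; map; applyUpTo; foldr)
open import Data.Nat.ListAction using (sum)
open import Data.List.Membership.Propositional using (_∈_; _∉_)
open import Data.List.Relation.Unary.Unique.Propositional using (Unique)
open import Data.Product using (_×_; ∃; ∃-syntax)
open import Relation.Binary.PropositionalEquality using (_≡_)
open import Function.Bundles using (_⇔_)

-- A finite subset of ℕ is represented by a duplicate-free list; x ∈ A is list membership.

InInterval : ℕ → ℕ → ℕ → Set
InInterval a b x = (a ≤ x) × (x ≤ b)

-- A is an m-extension: A ⊂ ℕ (positive integers) finite, and there is t ∈ ℕ₀ and
-- blocks B 0, …, B t (B i x means x ∈ A_i) forming a partition of A with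
-- A_0 = [1,m-1] and A_{i+1} ⊆ m + A_i for all i < t.
-- ([1,m-1] ⊆ A follows from A_0 = [1,m-1] being one of the blocks.)
IsExtension : ℕ → List ℕ → Set₁
IsExtension m A =
  Unique A ×
  (∀ x → x ∈ A → 1 ≤ x) ×
  ∃[ t ] ∃ λ (B : ℕ → ℕ → Set) →
    ( (∀ x → (x ∈ A) ⇔ (∃[ i ] (i ≤ t × B i x)))
    × (∀ i j x → i ≤ t → j ≤ t → B i x → B j x → i ≡ j)
    × (∀ x → B 0 x ⇔ InInterval 1 (m ∸ 1) x)
    × (∀ i x → i < t → B (suc i) x → ∃[ y ] (B i y × x ≡ m + y)) )

genus : List ℕ → ℕ
genus = length

IsConductor : List ℕ → ℕ → Set
IsConductor A c =
  (∀ n → (c + n) ∉ A) ×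
  (∀ s → (∀ n → (s + n) ∉ A) → c ≤ s)

-- ceiling division ⌈ c / m ⌉ (for m > 0; value at m = 0 is irrelevant)
ceilDiv : ℕ → ℕ → ℕ
ceilDiv c zero    = 0
ceilDiv c (suc k) = (c + k) / suc k

depth : ℕ → ℕ → ℕ
depth m c = ceilDiv c m

IsMaxInClass : ℕ → List ℕ → ℕ → ℕ → Set
IsMaxInClass m A i a =
  a ∈ A × (a % suc (m ∸ 1) ≡ i % suc (m ∸ 1)) ×
  (∀ b → b ∈ A → b % suc (m ∸ 1) ≡ i % suc (m ∸ 1) → b ≤ a)

-- k : ℕ → ℕ gives the pseudo Kunz coordinates (k 1, …, k (m-1)) of A:
-- for each i ∈ [1,m-1], w_i = m + max{a ∈ A : a ≡ i mod m} = m * k i + i.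
IsKunzP : ℕ → List ℕ → (ℕ → ℕ) → Set
IsKunzP m A k =
  ∀ i → InInterval 1 (m ∸ 1) i →
    ∃[ a ] (IsMaxInClass m A i a × m * k i + i ≡ m + a)

indices : ℕ → List ℕ
indices m = applyUpTo suc (m ∸ 1)

sumK : ℕ → (ℕ → ℕ) → ℕ
sumK m k = sum (map k (indices m))

maxK : ℕ → (ℕ → ℕ) → ℕ
maxK m k = foldr _⊔_ 0 (map k (indices m))

-- Each residue column r, r + m, r + 2m, … of an m-extension meets A in an initial segment:
-- stepping down by m from A_{i+1} lands in A_i, since A_{i+1} ⊆ m + A_i. The top of column r
-- is max(A ∩ (r + mℕ)) = w_r − m = r + (k_r − 1) m, so A is exactly the set of r + j m with
-- 1 ≤ r ≤ m − 1 and j < k_r. Counting this set gives g = Σ k_r. Every such element is below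
-- (max k) m, so c ≤ (max k) m; and each top r + (k_r − 1) m lies in A, hence below c, so
-- k_r ≤ ⌈c/m⌉ for every r.
module Submission where

open import Defs
open import Data.Nat
  using (ℕ; zero; suc; _+_; _*_; _∸_; _≤_; _<_; _⊔_; _≤′_; ≤′-refl; ≤′-step; s≤s; s≤s⁻¹; z≤n; NonZero)
open import Data.Nat.Properties
open import Data.Nat.DivMod using (_/_; _%_; [m+kn]%n≡m%n; m<n⇒m%n≡m; m<n*o⇒m/o<n; /-monoˡ-≤; m*n/n≡m)
open import Data.Nat.Tactic.RingSolver using (solve-∀)
open import Data.Nat.ListAction using (sum)
open import Data.List using (List; []; _∷_; length; map; applyUpTo; foldr; concatMap)
open import Data.List.Properties using (length-++; length-applyUpTo; foldr-preservesᵇ)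
open import Data.List.Membership.Propositional using (_∈_; find; lose)
open import Data.List.Membership.Propositional.Properties
  using (∈-applyUpTo⁺; ∈-applyUpTo⁻; ∈-concatMap⁺; ∈-concatMap⁻; ∈-map⁺)
open import Data.List.Membership.Propositional.Properties.WithK using (unique∧set⇒bag)
open import Data.List.Relation.Unary.Any using (here; there)
open import Data.List.Relation.Unary.All as All using (All; []; _∷_)
import Data.List.Relation.Unary.All.Properties as All
open import Data.List.Relation.Unary.AllPairs using ([]; _∷_)
open import Data.List.Relation.Unary.Unique.Propositional using (Unique)
import Data.List.Relation.Unary.Unique.Propositional.Properties as Unique
open import Data.List.Relation.Binary.Disjoint.Propositional using (Disjoint)
open import Data.List.Relation.Binary.BagAndSetEquality using (∼bag⇒↭)
open import Data.List.Relation.Binary.Permutation.Propositional.Properties using (↭-length)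
open import Data.Product using (∃-syntax; _×_; _,_; proj₁; proj₂)
open import Data.Sum using (inj₁; inj₂)
open import Relation.Nullary using (contradiction)
open import Relation.Binary.PropositionalEquality
open import Function using (_∘′_)
open import Function.Bundles using (_⇔_; mk⇔; Equivalence)
import Function.Properties.Equivalence as ⇔

KunzSet : ℕ → (ℕ → ℕ) → ℕ → Set
KunzSet m k x = ∃[ r ] (InInterval 1 (m ∸ 1) r × ∃[ j ] (j < k r × x ≡ r + j * m))

column-shift : ∀ m r i → m + (r + i * m) ≡ r + suc i * m
column-shift = solve-∀

module _ {m : ℕ} .{{_ : NonZero m}} where

  residue-injective : ∀ {r r′} q → r < m → r′ < m → (r + q * m) % m ≡ r′ % m → r ≡ r′
  residue-injective {r} {r′} q r<m r′<m eq = begin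
    r                ≡⟨ m<n⇒m%n≡m r<m ⟨
    r % m            ≡⟨ [m+kn]%n≡m%n r q m ⟨
    (r + q * m) % m  ≡⟨ eq ⟩
    r′ % m           ≡⟨ m<n⇒m%n≡m r′<m ⟩
    r′               ∎
    where open ≡-Reasoning

  r+qm-injective : ∀ {r r′ q q′} → r < m → r′ < m → r + q * m ≡ r′ + q′ * m → r ≡ r′ × q ≡ q′
  r+qm-injective {r} {r′} {q} {q′} r<m r′<m eq = r≡r′ , *-cancelʳ-≡ q q′ m qm≡q′m
    where
      r≡r′ : r ≡ r′
      r≡r′ = residue-injective q r<m r′<m (trans (cong (_% m) eq) ([m+kn]%n≡m%n r′ q′ m))
      qm≡q′m : q * m ≡ q′ * m
      qm≡q′m = +-cancelˡ-≡ r _ _ (trans eq (cong (_+ q′ * m) (sym r≡r′)))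

  m*q+r≡m+[r+i*m]⇒q≡1+i : ∀ {q r i} → m * q + r ≡ m + (r + i * m) → q ≡ suc i
  m*q+r≡m+[r+i*m]⇒q≡1+i {q} {r} {i} eq =
    *-cancelˡ-≡ q (suc i) m (+-cancelʳ-≡ r _ _ (trans eq (shift m r i)))
    where
      shift : ∀ m r i → m + (r + i * m) ≡ m * suc i + r
      shift = solve-∀

ceilDiv-≤ : ∀ {c q} n → c ≤ q * suc n → ceilDiv c (suc n) ≤ q
ceilDiv-≤ {c} {q} n c≤qm = s≤s⁻¹ (m<n*o⇒m/o<n (begin-strict
  c + n          ≤⟨ +-monoˡ-≤ n c≤qm ⟩
  q * suc n + n  ≡⟨ +-comm (q * suc n) n ⟩
  n + q * suc n  <⟨ n<1+n _ ⟩
  suc q * suc n  ∎))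
  where open ≤-Reasoning

<-ceilDiv : ∀ {c q} n → q * suc n < c → q < ceilDiv c (suc n)
<-ceilDiv {c} {q} n qm<c = begin
  suc q                  ≡⟨ m*n/n≡m (suc q) (suc n) ⟨
  suc q * suc n / suc n  ≤⟨ /-monoˡ-≤ (suc n) [1+q]m≤c+n ⟩
  (c + n) / suc n        ∎
  where
    open ≤-Reasoning
    [1+q]m≤c+n : suc q * suc n ≤ c + n
    [1+q]m≤c+n = ≤-trans (≤-reflexive (cong suc (+-comm n (q * suc n)))) (+-monoˡ-≤ n qm<c)

module _ {A : List ℕ} {c : ℕ} (conductor : IsConductor A c) where

  ∈⇒<conductor : ∀ {x} → x ∈ A → x < c
  ∈⇒<conductor {x} x∈A with <-≤-connex x c
  ... | inj₁ x<c = x<c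
  ... | inj₂ c≤x =
    contradiction (subst (_∈ A) (sym (m+[n∸m]≡n c≤x)) x∈A) (proj₁ conductor (x ∸ c))

  conductor-≤ : ∀ {u} → (∀ {x} → x ∈ A → x < u) → c ≤ u
  conductor-≤ {u} A<u = proj₂ conductor u (λ n u+n∈A → <⇒≱ (A<u u+n∈A) (m≤m+n u n))

≤-foldr-⊔ : ∀ {x} xs → x ∈ xs → x ≤ foldr _⊔_ 0 xs
≤-foldr-⊔ (y ∷ ys) (here refl)  = m≤m⊔n y _
≤-foldr-⊔ (y ∷ ys) (there x∈ys) = m≤n⇒m≤o⊔n y (≤-foldr-⊔ ys x∈ys)

foldr-⊔-≤ : ∀ {v} xs → All (_≤ v) xs → foldr _⊔_ 0 xs ≤ v
foldr-⊔-≤ xs = foldr-preservesᵇ ⊔-lub z≤n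

module _ {n t : ℕ} {A : List ℕ} {B : ℕ → ℕ → Set}
         (partition : ∀ x → (x ∈ A) ⇔ (∃[ i ] (i ≤ t × B i x)))
         (B₀ : ∀ x → B 0 x ⇔ InInterval 1 n x)
         (B-suc : ∀ i x → i < t → B (suc i) x → ∃[ y ] (B i y × x ≡ suc n + y)) where

  private
    m : ℕ
    m = suc n

  block⇒column : ∀ {i x} → i ≤ t → B i x → ∃[ r ] (InInterval 1 n r × x ≡ r + i * m)
  block⇒column {zero}  {x} _   x∈B₀ = x , Equivalence.to (B₀ x) x∈B₀ , sym (+-identityʳ x)
  block⇒column {suc i} {x} i<t x∈B
    with y , y∈B , refl ← B-suc i x i<t x∈B
    with r , r∈ , refl ← block⇒column (<⇒≤ i<t) y∈B
    = r , r∈ , column-shift m r i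

  block-pred : ∀ {i r} → i < t → B (suc i) (r + suc i * m) → B i (r + i * m)
  block-pred {i} {r} i<t x∈B with y , y∈B , eq ← B-suc i _ i<t x∈B =
    subst (B i) (+-cancelˡ-≡ m y (r + i * m) (trans (sym eq) (sym (column-shift m r i)))) y∈B

  block-down : ∀ {i j r} → j ≤′ i → i ≤ t → B i (r + i * m) → B j (r + j * m)
  block-down ≤′-refl           _   x∈B = x∈B
  block-down (≤′-step j≤′i) i<t x∈B = block-down j≤′i (<⇒≤ i<t) (block-pred i<t x∈B)

  ∈⇒column : ∀ {x} → x ∈ A → ∃[ r ] (InInterval 1 n r × ∃[ i ] (x ≡ r + i * m))
  ∈⇒column {x} x∈A with i , i≤t , x∈B ← Equivalence.to (partition x) x∈A
    with r , r∈ , eq ← block⇒column i≤t x∈B = r , r∈ , i , eq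

  column-downClosed : ∀ {r i j} → r < m → j ≤ i → r + i * m ∈ A → r + j * m ∈ A
  column-downClosed {r} {i} {j} r<m j≤i x∈A
    with i′ , i′≤t , x∈B ← Equivalence.to (partition _) x∈A
    with r′ , (_ , r′≤n) , eq ← block⇒column i′≤t x∈B
    with refl , refl ← r+qm-injective {q = i} {q′ = i′} r<m (s≤s r′≤n) eq
    = Equivalence.from (partition _) (j , ≤-trans j≤i i′≤t , block-down (≤⇒≤′ j≤i) i′≤t x∈B)

  module _ {k : ℕ → ℕ} (kunz : IsKunzP m A k) where

    record ColumnTop (r : ℕ) : Set where
      field
        height       : ℕ
        k≡1+height   : k r ≡ suc height
        top∈A        : r + height * m ∈ A
        ≤height      : ∀ {j} → r + j * m ∈ A → j ≤ height

    columnTop : ∀ {r} → InInterval 1 n r → ColumnTop r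
    columnTop {r} r∈@(_ , r≤n)
      with a , (a∈A , a≡r , a-max) , w≡m+a ← kunz r r∈
      with r′ , (_ , r′≤n) , i , refl ← ∈⇒column a∈A
      with refl ← residue-injective i (s≤s r′≤n) (s≤s r≤n) a≡r
      = record
        { height     = i
        ; k≡1+height = m*q+r≡m+[r+i*m]⇒q≡1+i {m = m} w≡m+a
        ; top∈A      = a∈A
        ; ≤height    = λ {j} x∈A →
            *-cancelʳ-≤ j i m (+-cancelˡ-≤ r _ _ (a-max _ x∈A ([m+kn]%n≡m%n r j m)))
        }

    ∈⇔KunzSet : ∀ {x} → x ∈ A ⇔ KunzSet m k x
    ∈⇔KunzSet = mk⇔ to from
      where
        to : ∀ {x} → x ∈ A → KunzSet m k x
        to x∈A with r , r∈ , i , refl ← ∈⇒column x∈A =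
          r , r∈ , i , subst (i <_) (sym k≡1+height) (s≤s (≤height x∈A)) , refl
          where open ColumnTop (columnTop r∈)
        from : ∀ {x} → KunzSet m k x → x ∈ A
        from (r , r∈ , j , j<kr , refl) =
          column-downClosed (s≤s (proj₂ r∈)) (s≤s⁻¹ (subst (j <_) k≡1+height j<kr)) top∈A
          where open ColumnTop (columnTop r∈)

∈-indices⇔ : ∀ {n r} → r ∈ indices (suc n) ⇔ InInterval 1 n r
∈-indices⇔ {n} = mk⇔ to from
  where
    to : ∀ {r} → r ∈ indices (suc n) → InInterval 1 n r
    to r∈ with i , i<n , refl ← ∈-applyUpTo⁻ suc r∈ = s≤s z≤n , i<n
    from : ∀ {r} → InInterval 1 n r → r ∈ indices (suc n)
    from {suc i} (_ , i<n) = ∈-applyUpTo⁺ suc i<n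

indices-unique : ∀ n → Unique (indices (suc n))
indices-unique n = Unique.applyUpTo⁺₁ suc n (λ i<j _ → <⇒≢ i<j ∘′ suc-injective)

column : ℕ → (ℕ → ℕ) → ℕ → List ℕ
column m k r = applyUpTo (λ j → r + j * m) (k r)

columns : ℕ → (ℕ → ℕ) → List ℕ → List ℕ
columns m k = concatMap (column m k)

module _ {m : ℕ} {k : ℕ → ℕ} where

  length-columns : ∀ rs → length (columns m k rs) ≡ sum (map k rs)
  length-columns []       = refl
  length-columns (r ∷ rs) =
    trans (length-++ (column m k r)) (cong₂ _+_ (length-applyUpTo _ (k r)) (length-columns rs))

  ∈-columns⇔ : ∀ {rs x} →
               x ∈ columns m k rs ⇔ (∃[ r ] (r ∈ rs × ∃[ j ] (j < k r × x ≡ r + j * m)))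
  ∈-columns⇔ {rs} = mk⇔ to from
    where
      to : ∀ {x} → x ∈ columns m k rs → ∃[ r ] (r ∈ rs × ∃[ j ] (j < k r × x ≡ r + j * m))
      to x∈ with r , r∈rs , x∈column ← find (∈-concatMap⁻ (column m k) {xs = rs} x∈) =
        r , r∈rs , ∈-applyUpTo⁻ _ x∈column
      from : ∀ {x} → ∃[ r ] (r ∈ rs × ∃[ j ] (j < k r × x ≡ r + j * m)) → x ∈ columns m k rs
      from (r , r∈rs , j , j<kr , refl) =
        ∈-concatMap⁺ (column m k) (lose r∈rs (∈-applyUpTo⁺ (λ j → r + j * m) j<kr))

  columns-unique : .{{_ : NonZero m}} → ∀ {rs} →
                   Unique rs → All (_< m) rs → Unique (columns m k rs)
  columns-unique []               []           = []
  columns-unique {r ∷ rs} (r∉rs ∷ rs-uniq) (r<m ∷ rs<m) =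
    Unique.++⁺ column-unique (columns-unique rs-uniq rs<m) disjoint
    where
      column-unique : Unique (column m k r)
      column-unique = Unique.applyUpTo⁺₁ _ (k r)
        (λ i<j _ eq → <⇒≢ i<j (proj₂ (r+qm-injective r<m r<m eq)))
      disjoint : Disjoint (column m k r) (columns m k rs)
      disjoint (x∈column , x∈columns)
        with j , _ , refl ← ∈-applyUpTo⁻ _ x∈column
           | r′ , r′∈rs , j′ , _ , eq ← Equivalence.to (∈-columns⇔ {rs}) x∈columns =
        All.lookup r∉rs r′∈rs
          (proj₁ (r+qm-injective {q = j} {q′ = j′} r<m (All.lookup rs<m r′∈rs) eq))

∈-kunzColumns⇔ : ∀ {n k x} → x ∈ columns (suc n) k (indices (suc n)) ⇔ KunzSet (suc n) k x
∈-kunzColumns⇔ = mk⇔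
  (λ x∈ → let r , r∈ , rest = Equivalence.to ∈-columns⇔ x∈ in
          r , Equivalence.to ∈-indices⇔ r∈ , rest)
  (λ (r , r∈ , rest) → Equivalence.from ∈-columns⇔ (r , Equivalence.from ∈-indices⇔ r∈ , rest))

genus≡sumK : ∀ {n k A} → Unique A → (∀ {x} → x ∈ A ⇔ KunzSet (suc n) k x) →
             genus A ≡ sumK (suc n) k
genus≡sumK {n} {k} {A} A-uniq A⇔ = begin
  length A                ≡⟨ ↭-length (∼bag⇒↭ (unique∧set⇒bag A-uniq columns-uniq A⇔columns)) ⟩
  length (columns m k rs) ≡⟨ length-columns rs ⟩
  sumK m k                ∎
  where
    open ≡-Reasoning
    m = suc n
    rs = indices m
    columns-uniq : Unique (columns m k rs)
    columns-uniq = columns-unique (indices-unique n)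
      (All.tabulate (λ r∈ → s≤s (proj₂ (Equivalence.to ∈-indices⇔ r∈))))
    A⇔columns : ∀ {x} → x ∈ A ⇔ x ∈ columns m k rs
    A⇔columns = ⇔.trans A⇔ (⇔.sym ∈-kunzColumns⇔)

depth≡maxK : ∀ {n k A c} → IsConductor A c → (∀ {x} → x ∈ A ⇔ KunzSet (suc n) k x) →
             depth (suc n) c ≡ maxK (suc n) k
depth≡maxK {n} {k} {A} {c} conductor A⇔ =
  ≤-antisym (ceilDiv-≤ n (conductor-≤ conductor A<maxK*m))
            (foldr-⊔-≤ (map k (indices m)) (All.map⁺ (All.tabulate k≤depth)))
  where
    m = suc n
    A<maxK*m : ∀ {x} → x ∈ A → x < maxK m k * m
    A<maxK*m x∈A with r , r∈ , j , j<kr , refl ← Equivalence.to A⇔ x∈A = begin-strict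
      r + j * m     <⟨ +-monoˡ-< (j * m) (s≤s (proj₂ r∈)) ⟩
      suc j * m     ≤⟨ *-monoˡ-≤ m (≤-trans j<kr kr≤maxK) ⟩
      maxK m k * m  ∎
      where
        open ≤-Reasoning
        kr≤maxK : k r ≤ maxK m k
        kr≤maxK = ≤-foldr-⊔ (map k (indices m)) (∈-map⁺ k (Equivalence.from ∈-indices⇔ r∈))
    k≤depth : ∀ {r} → r ∈ indices m → k r ≤ depth m c
    k≤depth {r} r∈ with k r in kr≡
    ... | zero  = z≤n
    ... | suc j = <-ceilDiv n (≤-<-trans (m≤n+m (j * m) r) (∈⇒<conductor conductor top∈A))
      where
        top∈A : r + j * m ∈ A
        top∈A = Equivalence.from A⇔
          (r , Equivalence.to ∈-indices⇔ r∈ , j , subst (j <_) (sym kr≡) ≤-refl , refl)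

corollary3p2 : (m : ℕ) → 1 < m → (A : List ℕ) → IsExtension m A →
    (k : ℕ → ℕ) → IsKunzP m A k → (c : ℕ) → IsConductor A c →
    (genus A ≡ sumK m k) × (depth m c ≡ maxK m k)
corollary3p2 (suc n) _ A (A-uniq , _ , t , B , partition , _ , B₀ , B-suc) k kunz c conductor =
  genus≡sumK A-uniq A⇔KunzSet , depth≡maxK conductor A⇔KunzSet
  where
    A⇔KunzSet : ∀ {x} → x ∈ A ⇔ KunzSet (suc n) k x
    A⇔KunzSet = ∈⇔KunzSet partition B₀ B-suc kunz
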